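{- Let $p$ be a prime, $m$ a positive integer divisible by $3$, $n=\frac m3(p-1)$, $U=[0,n]^2$. Let $J,K,L$ be ideals of $U$ and let $a,b,c,d$ be nonnegative integers such that $\bigl[J+D+(a,-b)\bigr]\cap U\subseteq K$ and $\bigl[K+D+(c,-d)\bigr]\cap U\subseteq L$. Assume moreover that $K\ne\emptyset$, $K\neq U$, and that the walk $\omega_U(K)$ is not a single horizontal step. Then $\bigl[J+D+(a+c,-b-d)\bigr]\cap U\subseteq L$.
   Context: $D=\{(x,y)\in\mathbb{R}^2: x+py\le 0,\ p^2x+y\le 0\}$; $u\prec v$ means $u\in v+D$. An ideal of $\Omega\subseteq\mathbb{R}^2$ is $I\subseteq\Omega$ with $u\in I$, $v\in\Omega$, $v\prec u\Rightarrow v\in I$. $[a,b]=\{x\in\mathbb{Z}:a\le x\le b\}$; sums are Minkowski sums. Walks: for a rectangle $R=[a,b]\times[c,d]$, a walk in $R$ is the empty sequence or a sequence $(x_0,y_0),\dots,(x_k,y_k)$ of points of $R$ with: (1) $x_0=a$ or $y_0=d$, and $x_k=b$ or $y_k=c$; (2) each step is horizontal, $(x_t,y_t)=(x_{t-1}+h,y_{t-1})$ with $1\le h\le p$, or vertical, $(x_t,y_t)=(x_{t-1},y_{t-1}-v)$ with $1\le v\le p^2$; (3) steps alternate; (4) if $a\le x_0<b$ and $y_0=d$ the first step is vertical, and if $x_k=b$, $c\le y_k<d$ the last step is horizontal; (5) a horizontal first step has length $\le p-1$ and a vertical last step has length $\le p^2-1$. The map $W\mapsto\{(x,y)\in R: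 x\le x_t,\ y\le y_t\text{ for some }t\}$ (empty walk $\mapsto\emptyset$) is a bijection from walks in $R$ to ideals of $R$; $\omega_R$ denotes its inverse (the boundary walk of an ideal). "A single horizontal step" means a walk with exactly two points forming a horizontal step. -}

module Defs where

open import Data.Nat as ℕ using (ℕ)
open import Data.Integer using (ℤ; +_; _+_; _-_; _*_; -_; _≤_; _<_)
open import Data.Product using (_×_; _,_; ∃; proj₁; proj₂)
open import Data.Sum using (_⊎_)
open import Data.Unit using (⊤)
open import Data.Empty using (⊥)
open import Data.List using (List; []; _∷_)
open import Data.List.Relation.Unary.Any using (Any)
open import Relation.Nullary using (¬_)
open import Relation.Binary.PropositionalEquality using (_≡_)

-- Lattice points of ℝ² (all sets in the statement are subsets of U ⊆ ℤ²).
Pt : Set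
Pt = ℤ × ℤ

PtSet : Set₁
PtSet = Pt → Set

_⊆_ : PtSet → PtSet → Set
A ⊆ B = ∀ z → A z → B z

_≐_ : PtSet → PtSet → Set
A ≐ B = (A ⊆ B) × (B ⊆ A)

_⊕_ : Pt → Pt → Pt
(x , y) ⊕ (x' , y') = (x + x' , y + y')

_⊖_ : Pt → Pt → Pt
(x , y) ⊖ (x' , y') = (x - x' , y - y')

InD : ℕ → Pt → Set
InD p (x , y) = (x + (+ p) * y ≤ + 0) × ((+ p) * (+ p) * x + y ≤ + 0)

Prec : ℕ → Pt → Pt → Set
Prec p u v = InD p (u ⊖ v)

Rect : ℤ → ℤ → ℤ → ℤ → PtSet
Rect a b c d (x , y) = (a ≤ x × x ≤ b) × (c ≤ y × y ≤ d)

Sq : ℕ → PtSet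
Sq n = Rect (+ 0) (+ n) (+ 0) (+ n)

IsIdeal : ℕ → PtSet → PtSet → Set
IsIdeal p Ω I = (I ⊆ Ω) × (∀ u v → I u → Ω v → Prec p v u → I v)

-- [ J + D + s ] ∩ Ω  (Minkowski sum; with J ⊆ ℤ² and Ω ⊆ ℤ² only the lattice
-- points of D matter, since u - j - s is then a lattice point).
SumCap : ℕ → PtSet → Pt → PtSet → PtSet
SumCap p J s Ω u = Ω u × ∃ λ j → J j × InD p ((u ⊖ j) ⊖ s)

HStep : ℕ → Pt → Pt → Set
HStep p (x , y) (x' , y') = (y' ≡ y) × (+ 1 ≤ x' - x × x' - x ≤ + p)

VStep : ℕ → Pt → Pt → Set
VStep p (x , y) (x' , y') = (x' ≡ x) × (+ 1 ≤ y - y' × y - y' ≤ (+ p) * (+ p))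

StepsOK : ℕ → List Pt → Set
StepsOK p (u ∷ v ∷ r) = (HStep p u v ⊎ VStep p u v) × StepsOK p (v ∷ r)
StepsOK p _ = ⊤

Alternates : ℕ → List Pt → Set
Alternates p (u ∷ v ∷ w ∷ r) =
  (¬ (HStep p u v × HStep p v w)) × (¬ (VStep p u v × VStep p v w))
  × Alternates p (v ∷ w ∷ r)
Alternates p _ = ⊤

AllIn : PtSet → List Pt → Set
AllIn R [] = ⊤
AllIn R (u ∷ r) = R u × AllIn R r

LastCond : ℕ → ℤ → ℤ → ℤ → ℤ → List Pt → Set
LastCond p a b c d ((x , y) ∷ []) = x ≡ b ⊎ y ≡ c
LastCond p a b c d ((x' , y') ∷ (x , y) ∷ []) =
  (x ≡ b ⊎ y ≡ c)
  × ((x ≡ b × c ≤ y × y < d) → HStep p (x' , y') (x , y))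
  × (VStep p (x' , y') (x , y) → y' - y ≤ (+ p) * (+ p) - + 1)
LastCond p a b c d (u ∷ v ∷ w ∷ r) = LastCond p a b c d (v ∷ w ∷ r)
LastCond p a b c d [] = ⊤

FirstCond : ℕ → ℤ → ℤ → ℤ → ℤ → List Pt → Set
FirstCond p a b c d [] = ⊤
FirstCond p a b c d ((x , y) ∷ []) = x ≡ a ⊎ y ≡ d
FirstCond p a b c d ((x , y) ∷ (x' , y') ∷ r) =
  (x ≡ a ⊎ y ≡ d)
  × ((a ≤ x × x < b × y ≡ d) → VStep p (x , y) (x' , y'))
  × (HStep p (x , y) (x' , y') → x' - x ≤ + p - + 1)

IsWalk : ℕ → ℤ → ℤ → ℤ → ℤ → List Pt → Set
IsWalk p a b c d W =
  AllIn (Rect a b c d) W × FirstCond p a b c d W × LastCond p a b c d W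
  × StepsOK p W × Alternates p W

WalkIdeal : ℤ → ℤ → ℤ → ℤ → List Pt → PtSet
WalkIdeal a b c d W (x , y) =
  Rect a b c d (x , y) × Any (λ q → x ≤ proj₁ q × y ≤ proj₂ q) W

SingleHStep : ℕ → List Pt → Set
SingleHStep p (u ∷ v ∷ []) = HStep p u v
SingleHStep p _ = ⊥

-- "ω_R(I) is not a single horizontal step": since W ↦ WalkIdeal W is a
-- bijection from walks in R to ideals of R, ω_R(I) is the unique walk whose
-- ideal is I.
BoundaryWalkNotSingleHStep : ℕ → ℤ → ℤ → ℤ → ℤ → PtSet → Set
BoundaryWalkNotSingleHStep p a b c d I =
  (W : List Pt) → IsWalk p a b c d W → WalkIdeal a b c d W ≐ I → ¬ SingleHStep p W

module Submission where

-- Write u = j + e + (a + c , -(b + d)) with j ∈ J and e ∈ D, and put P = j + (a , -b), Q = u - (c , -d), so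
-- that Q ≺ P. Any k ∈ U with Q ≺ k ≺ P lies in K by the first inclusion, and then u ∈ L by the second. If
-- Q₂ ≤ P₂ such a k is Q or (0 , Q₂). Otherwise Q - P = α (-p , 1) + β (-1 , 0) with α, β ≥ 0, and we walk
-- from P to Q by these steps: while the walk is outside U it either steps towards U, or it has reached a
-- point below (0 , 0), which lies in K since K is a nonempty ideal, or a point above (n , n), which would force
-- K = U. On the right of U the step (-p , 1) keeps x ≥ 0 because p ≤ n + 1.

open import Defs
open import Data.Nat as ℕ using (ℕ; zero; suc; NonZero; _∸_; _/_)
import Data.Nat.Properties as ℕ
open import Data.Nat.Divisibility using (_∣_; ∣⇒≤)
open import Data.Nat.DivMod using (m≥n⇒m/n>0)
open import Data.Nat.Primality using (Prime; prime⇒nonZero)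
open import Data.Integer as ℤ using (+_; -_; +≤+)
open import Data.Integer.Properties using (pos-+; neg-distrib-+; neg-≤-pos)
open import Data.Product using (_,_; proj₁; proj₂; ∃)
open import Relation.Binary.PropositionalEquality
  using (_≡_; sym; trans; cong; cong₂; subst; module ≡-Reasoning)
open import Relation.Nullary using (¬_; yes; no; contradiction)

-- The operations of ℤ are opened only in this module, so that _+_ and _*_ in the statement are those of ℕ.
module _ where

  open import Data.Integer
    using (ℤ; _+_; _-_; _*_; _≤_; _<_; _≤?_; 0ℤ; 1ℤ; ∣_∣; pred) renaming (suc to sucℤ)
  open import Data.Integer.Properties
  open import Data.Integer.Tactic.RingSolver using (solve-∀)
  open ≡-Reasoning

  i≤0⇒+n*i≤0 : ∀ n {i} → i ≤ 0ℤ → + n * i ≤ 0ℤ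
  i≤0⇒+n*i≤0 n i≤0 = ≤-trans (*-monoˡ-≤-nonNeg (+ n) i≤0) (≤-reflexive (*-zeroʳ (+ n)))

  ⊖-telescope : ∀ u v w → (u ⊖ v) ⊕ (v ⊖ w) ≡ u ⊖ w
  ⊖-telescope (u₁ , u₂) (v₁ , v₂) (w₁ , w₂) = cong₂ _,_ (identity u₁ v₁ w₁) (identity u₂ v₂ w₂)
    where
    identity : ∀ a b c → (a - b) + (b - c) ≡ a - c
    identity = solve-∀

  ⊖-⊕ : ∀ u v w → u ⊖ (v ⊕ w) ≡ (u ⊖ v) ⊖ w
  ⊖-⊕ (u₁ , u₂) (v₁ , v₂) (w₁ , w₂) = cong₂ _,_ (identity u₁ v₁ w₁) (identity u₂ v₂ w₂)
    where
    identity : ∀ a b c → a - (b + c) ≡ (a - b) - c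
    identity = solve-∀

  ⊖-⊖-comm : ∀ u v w → (u ⊖ v) ⊖ w ≡ (u ⊖ w) ⊖ v
  ⊖-⊖-comm (u₁ , u₂) (v₁ , v₂) (w₁ , w₂) = cong₂ _,_ (identity u₁ v₁ w₁) (identity u₂ v₂ w₂)
    where
    identity : ∀ a b c → (a - b) - c ≡ (a - c) - b
    identity = solve-∀

  module Cone (p : ℕ) where

    InD-+ : ∀ {u v} → InD p u → InD p v → InD p (u ⊕ v)
    InD-+ {x , y} {x′ , y′} (l₁ , l₂) (r₁ , r₂) =
      subst (_≤ 0ℤ) (sym (split₁ (+ p) x x′ y y′)) (+-mono-≤ l₁ r₁) ,
      subst (_≤ 0ℤ) (sym (split₂ (+ p) x x′ y y′)) (+-mono-≤ l₂ r₂)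
      where
      split₁ : ∀ q x x′ y y′ → (x + x′) + q * (y + y′) ≡ (x + q * y) + (x′ + q * y′)
      split₁ = solve-∀
      split₂ : ∀ q x x′ y y′ → q * q * (x + x′) + (y + y′) ≡ (q * q * x + y) + (q * q * x′ + y′)
      split₂ = solve-∀

    InD-nonPos : ∀ {x y} → x ≤ 0ℤ → y ≤ 0ℤ → InD p (x , y)
    InD-nonPos {x} x≤0 y≤0 =
      +-mono-≤ x≤0 (i≤0⇒+n*i≤0 p y≤0) ,
      +-mono-≤ (subst (_≤ 0ℤ) (sym (*-assoc (+ p) (+ p) x)) (i≤0⇒+n*i≤0 p (i≤0⇒+n*i≤0 p x≤0))) y≤0

    InD-diag : .{{_ : NonZero p}} → InD p (- + p , 1ℤ)
    InD-diag = ≤-reflexive (cancel (+ p)) , subst (_≤ 0ℤ) (sym (cube (+ p))) (i≤j⇒i-j≤0 1≤p³)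
      where
      cancel : ∀ q → - q + q * 1ℤ ≡ 0ℤ
      cancel = solve-∀
      cube : ∀ q → q * q * - q + 1ℤ ≡ 1ℤ - q * q * q
      cube = solve-∀
      1≤p : 1 ℕ.≤ p
      1≤p = ℕ.>-nonZero⁻¹ p
      1≤p³ : 1ℤ ≤ + p * + p * + p
      1≤p³ = subst (1ℤ ≤_) (trans (pos-* (p ℕ.* p) p) (cong (_* + p) (pos-* p p)))
               (+≤+ (ℕ.*-mono-≤ (ℕ.*-mono-≤ 1≤p 1≤p) 1≤p))

    -- Prec p u v unfolds to inequalities between coordinates, from which Agda cannot recover u and v;
    -- wrapping it in a record keeps the endpoints inferable.
    infix 4 _≺_
    record _≺_ (u v : Pt) : Set where
      constructor mk≺
      field prec : Prec p u v

    open _≺_ public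

    ≺-trans : ∀ {u v w} → u ≺ v → v ≺ w → u ≺ w
    ≺-trans {u} {v} {w} (mk≺ u≺v) (mk≺ v≺w) = mk≺ (subst (InD p) (⊖-telescope u v w) (InD-+ u≺v v≺w))

    ≤⇒≺ : ∀ {x y x′ y′} → x ≤ x′ → y ≤ y′ → (x , y) ≺ (x′ , y′)
    ≤⇒≺ x≤x′ y≤y′ = mk≺ (InD-nonPos (i≤j⇒i-j≤0 x≤x′) (i≤j⇒i-j≤0 y≤y′))

    ≺-refl : ∀ {u} → u ≺ u
    ≺-refl {_ , _} = ≤⇒≺ ≤-refl ≤-refl

    ≺-diag : .{{_ : NonZero p}} → ∀ {x y} → (x - + p , sucℤ y) ≺ (x , y)
    ≺-diag {x} {y} = mk≺ (subst (InD p) (sym (cong₂ _,_ (back (+ p) x) (up y))) InD-diag)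
      where
      back : ∀ q x → (x - q) - x ≡ - q
      back = solve-∀
      up : ∀ y → (1ℤ + y) - y ≡ 1ℤ
      up = solve-∀

  module Interpolation {p n : ℕ} .{{_ : NonZero p}} (p≤1+n : p ℕ.≤ suc n) where

    open Cone p

    N : ℤ
    N = + n

    0≤N : 0ℤ ≤ N
    0≤N = +≤+ ℕ.z≤n

    data Interpolant (Q P : Pt) : Set where
      through      : ∀ k → Sq n k → Q ≺ k → k ≺ P → Interpolant Q P
      below-origin : Q ≺ (0ℤ , 0ℤ) → Interpolant Q P
      above-corner : (N , N) ≺ P → Interpolant Q P

    Interpolant-widen : ∀ {Q P P′} → P ≺ P′ → Interpolant Q P → Interpolant Q P′
    Interpolant-widen P≺P′ (through k Uk Q≺k k≺P) = through k Uk Q≺k (≺-trans k≺P P≺P′)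
    Interpolant-widen P≺P′ (below-origin Q≺0)      = below-origin Q≺0
    Interpolant-widen P≺P′ (above-corner N≺P)      = above-corner (≺-trans N≺P P≺P′)

    module Path (Q₁ Q₂ : ℤ) (Q₁≤N : Q₁ ≤ N) (0≤Q₂ : 0ℤ ≤ Q₂) where

      pathˣ : ℕ → ℕ → ℤ
      pathˣ α β = Q₁ + (+ p * + α + + β)

      pathʸ : ℕ → ℤ
      pathʸ α = Q₂ - + α

      pathPt : ℕ → ℕ → Pt
      pathPt α β = pathˣ α β , pathʸ α

      pathˣ-diag : ∀ α β → pathˣ α β ≡ pathˣ (suc α) β - + p
      pathˣ-diag α β rewrite pos-+ 1 α = shift Q₁ (+ p) (+ α) (+ β)
        where
        shift : ∀ a q i j → a + (q * i + j) ≡ (a + (q * (1ℤ + i) + j)) - q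
        shift = solve-∀

      pathʸ-diag : ∀ α → pathʸ α ≡ sucℤ (pathʸ (suc α))
      pathʸ-diag α rewrite pos-+ 1 α = shift Q₂ (+ α)
        where
        shift : ∀ a i → a - i ≡ 1ℤ + (a - (1ℤ + i))
        shift = solve-∀

      pathˣ-left : ∀ α β → pathˣ α β ≡ pred (pathˣ α (suc β))
      pathˣ-left α β rewrite pos-+ 1 β = shift Q₁ (+ p * + α) (+ β)
        where
        shift : ∀ a i j → a + (i + j) ≡ - 1ℤ + (a + (i + (1ℤ + j)))
        shift = solve-∀

      pathˣ-origin : pathˣ 0 0 ≡ Q₁
      pathˣ-origin = vanish Q₁ (+ p)
        where
        vanish : ∀ a q → a + (q * 0ℤ + 0ℤ) ≡ a
        vanish = solve-∀

      pathʸ-origin : pathʸ 0 ≡ Q₂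
      pathʸ-origin = +-identityʳ Q₂

      pathʸ[1+α]<0⇒pathʸ[α]≤0 : ∀ α → pathʸ (suc α) < 0ℤ → pathʸ α ≤ 0ℤ
      pathʸ[1+α]<0⇒pathʸ[α]≤0 α y<0 = subst (_≤ 0ℤ) (sym (pathʸ-diag α)) (i<j⇒suc[i]≤j y<0)

      N<pathʸ[α]⇒N≤pathʸ[1+α] : ∀ α → N < pathʸ α → N ≤ pathʸ (suc α)
      N<pathʸ[α]⇒N≤pathʸ[1+α] α N<y =
        subst (N ≤_) (trans (cong pred (pathʸ-diag α)) (pred-suc _)) (i<j⇒i≤pred[j] N<y)

      N<pathˣ[α,1+β]⇒N≤pathˣ[α,β] : ∀ α β → N < pathˣ α (suc β) → N ≤ pathˣ α β
      N<pathˣ[α,1+β]⇒N≤pathˣ[α,β] α β N<x = subst (N ≤_) (sym (pathˣ-left α β)) (i<j⇒i≤pred[j] N<x)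

      N<pathˣ[1+α,β]⇒0≤pathˣ[α,β] : ∀ α β → N < pathˣ (suc α) β → 0ℤ ≤ pathˣ α β
      N<pathˣ[1+α,β]⇒0≤pathˣ[α,β] α β N<x = subst (0ℤ ≤_) (sym (pathˣ-diag α β))
        (i≤j⇒0≤j-i (≤-trans (+≤+ p≤1+n) (i<j⇒suc[i]≤j N<x)))

      path-≺-diag : ∀ α β → pathPt α β ≺ pathPt (suc α) β
      path-≺-diag α β = subst (_≺ pathPt (suc α) β)
                          (sym (cong₂ _,_ (pathˣ-diag α β) (pathʸ-diag α))) ≺-diag

      path-≺-left : ∀ α β → pathPt α β ≺ pathPt α (suc β)
      path-≺-left α β = subst (λ x → (x , pathʸ α) ≺ pathPt α (suc β))
                          (sym (pathˣ-left α β)) (≤⇒≺ (i≤j⇒pred[i]≤j ≤-refl) ≤-refl)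

      Q≺pathPt : ∀ α β → (Q₁ , Q₂) ≺ pathPt α β
      Q≺pathPt zero    zero    = subst (_≺ pathPt 0 0) (cong₂ _,_ pathˣ-origin pathʸ-origin) ≺-refl
      Q≺pathPt (suc α) β       = ≺-trans (Q≺pathPt α β) (path-≺-diag α β)
      Q≺pathPt zero    (suc β) = ≺-trans (Q≺pathPt zero β) (path-≺-left zero β)

      path-interpolant : ∀ α β → 0ℤ ≤ pathˣ α β → pathʸ α ≤ N → Interpolant (Q₁ , Q₂) (pathPt α β)
      path-interpolant α β 0≤x y≤N with pathˣ α β ≤? N | 0ℤ ≤? pathʸ α
      ... | yes x≤N | yes 0≤y = through (pathPt α β) ((0≤x , x≤N) , (0≤y , y≤N)) (Q≺pathPt α β) ≺-refl
      path-interpolant zero β _ _ | _ | no 0≰y =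
        contradiction (subst (0ℤ ≤_) (sym pathʸ-origin) 0≤Q₂) 0≰y
      path-interpolant (suc α) β _ _ | _ | no 0≰y with 0ℤ ≤? pathˣ α β
      ... | yes 0≤x′ = Interpolant-widen (path-≺-diag α β)
                         (path-interpolant α β 0≤x′ (≤-trans (pathʸ[1+α]<0⇒pathʸ[α]≤0 α (≰⇒> 0≰y)) 0≤N))
      ... | no 0≰x′ = below-origin (≺-trans (Q≺pathPt α β)
                         (≤⇒≺ (<⇒≤ (≰⇒> 0≰x′)) (pathʸ[1+α]<0⇒pathʸ[α]≤0 α (≰⇒> 0≰y))))
      path-interpolant α (suc β) _ y≤N | no x≰N | yes _ = Interpolant-widen (path-≺-left α β)
        (path-interpolant α β (≤-trans 0≤N (N<pathˣ[α,1+β]⇒N≤pathˣ[α,β] α β (≰⇒> x≰N))) y≤N)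
      path-interpolant zero zero _ _ | no x≰N | yes _ =
        contradiction (subst (_≤ N) (sym pathˣ-origin) Q₁≤N) x≰N
      path-interpolant (suc α) zero _ _ | no x≰N | yes _ with pathʸ α ≤? N
      ... | yes y′≤N = Interpolant-widen (path-≺-diag α 0)
                         (path-interpolant α 0 (N<pathˣ[1+α,β]⇒0≤pathˣ[α,β] α 0 (≰⇒> x≰N)) y′≤N)
      ... | no y′≰N = above-corner (≤⇒≺ (<⇒≤ (≰⇒> x≰N)) (N<pathʸ[α]⇒N≤pathʸ[1+α] α (≰⇒> y′≰N)))

    interpolate : ∀ {Q₁ Q₂ P₁ P₂} → Q₁ ≤ N → 0ℤ ≤ Q₂ → 0ℤ ≤ P₁ → P₂ ≤ N →
                  (Q₁ , Q₂) ≺ (P₁ , P₂) → Interpolant (Q₁ , Q₂) (P₁ , P₂)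
    interpolate {Q₁} {Q₂} {P₁} {P₂} Q₁≤N 0≤Q₂ 0≤P₁ P₂≤N Q≺P with Q₂ ≤? P₂
    ... | yes Q₂≤P₂ with 0ℤ ≤? Q₁
    ...   | yes 0≤Q₁ = through (Q₁ , Q₂) ((0≤Q₁ , Q₁≤N) , (0≤Q₂ , ≤-trans Q₂≤P₂ P₂≤N)) ≺-refl Q≺P
    ...   | no 0≰Q₁ = through (0ℤ , Q₂) ((≤-refl , 0≤N) , (0≤Q₂ , ≤-trans Q₂≤P₂ P₂≤N))
                         (≤⇒≺ (<⇒≤ (≰⇒> 0≰Q₁)) ≤-refl) (≤⇒≺ 0≤P₁ Q₂≤P₂)
    interpolate {Q₁} {Q₂} {P₁} {P₂} Q₁≤N 0≤Q₂ 0≤P₁ P₂≤N Q≺P | no Q₂≰P₂ =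
      subst (Interpolant (Q₁ , Q₂)) path-reaches-P
        (path-interpolant α β (subst (0ℤ ≤_) (sym (cong proj₁ path-reaches-P)) 0≤P₁)
                              (subst (_≤ N) (sym (cong proj₂ path-reaches-P)) P₂≤N))
      where
      open Path Q₁ Q₂ Q₁≤N 0≤Q₂
      α = ∣ Q₂ - P₂ ∣
      β = ∣ (P₁ - Q₁) - + p * (Q₂ - P₂) ∣
      +α : + α ≡ Q₂ - P₂
      +α = 0≤i⇒+∣i∣≡i (i≤j⇒0≤j-i (<⇒≤ (≰⇒> Q₂≰P₂)))
      negate : ∀ q a b c d → - ((a - b) + q * (c - d)) ≡ (b - a) - q * (c - d)
      negate = solve-∀
      -- β ≥ 0 is the first defining inequality of D for Q - P.
      +β : + β ≡ (P₁ - Q₁) - + p * (Q₂ - P₂)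
      +β = 0≤i⇒+∣i∣≡i (subst (0ℤ ≤_) (negate (+ p) Q₁ P₁ Q₂ P₂) (neg-mono-≤ (proj₁ (prec Q≺P))))
      cancelˣ : ∀ q a b c d → a + (q * (c - d) + ((b - a) - q * (c - d))) ≡ b
      cancelˣ = solve-∀
      cancelʸ : ∀ a b → a - (a - b) ≡ b
      cancelʸ = solve-∀
      path-reaches-P : pathPt α β ≡ (P₁ , P₂)
      path-reaches-P = cong₂ _,_
        (trans (cong₂ (λ i j → Q₁ + (+ p * i + j)) +α +β) (cancelˣ (+ p) Q₁ P₁ Q₂ P₂))
        (trans (cong (λ i → Q₂ - i) +α) (cancelʸ Q₂ P₂))

    Sq-origin : Sq n (0ℤ , 0ℤ)
    Sq-origin = (≤-refl , 0≤N) , (≤-refl , 0≤N)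

    Sq-corner : Sq n (N , N)
    Sq-corner = (0≤N , ≤-refl) , (0≤N , ≤-refl)

    origin≺ : ∀ {v} → Sq n v → (0ℤ , 0ℤ) ≺ v
    origin≺ {_ , _} ((0≤x , _) , (0≤y , _)) = ≤⇒≺ 0≤x 0≤y

    ≺corner : ∀ {v} → Sq n v → v ≺ (N , N)
    ≺corner {_ , _} ((_ , x≤N) , (_ , y≤N)) = ≤⇒≺ x≤N y≤N

    nonempty-ideal∋origin : ∀ {K} → IsIdeal p (Sq n) K → ∃ K → K (0ℤ , 0ℤ)
    nonempty-ideal∋origin (K⊆U , K↓) (z , Kz) = K↓ z (0ℤ , 0ℤ) Kz Sq-origin (prec (origin≺ (K⊆U z Kz)))

    ideal∋corner⇒≐Sq : ∀ {K} → IsIdeal p (Sq n) K → K (N , N) → K ≐ Sq n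
    ideal∋corner⇒≐Sq (K⊆U , K↓) KN = K⊆U , λ v Uv → K↓ (N , N) v KN Uv (prec (≺corner Uv))

    SumCap-compose : ∀ {J K L s₁ s₂ t₁ t₂} → J ⊆ Sq n → IsIdeal p (Sq n) K →
      0ℤ ≤ s₁ → s₂ ≤ 0ℤ → 0ℤ ≤ t₁ → t₂ ≤ 0ℤ →
      SumCap p J (s₁ , s₂) (Sq n) ⊆ K → SumCap p K (t₁ , t₂) (Sq n) ⊆ L →
      ∃ K → ¬ (K ≐ Sq n) →
      SumCap p J ((s₁ , s₂) ⊕ (t₁ , t₂)) (Sq n) ⊆ L
    SumCap-compose {_} {K} {L} {s₁} {s₂} {t₁} {t₂} J⊆U K-ideal 0≤s₁ s₂≤0 0≤t₁ t₂≤0 JsK KtL K≢∅ K≢U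
                   u@(u₁ , u₂) (Uu , j@(j₁ , j₂) , Jj , u-j-s-t∈D) =
      conclude (interpolate Q₁≤N 0≤Q₂ 0≤P₁ P₂≤N (mk≺ (subst (InD p) regroup u-j-s-t∈D)))
      where
      s = (s₁ , s₂)
      t = (t₁ , t₂)
      Uj = J⊆U j Jj
      Q₁≤N : u₁ - t₁ ≤ N
      Q₁≤N = ≤-trans (+-mono-≤ (proj₂ (proj₁ Uu)) (neg-mono-≤ 0≤t₁)) (≤-reflexive (+-identityʳ N))
      0≤Q₂ : 0ℤ ≤ u₂ - t₂
      0≤Q₂ = +-mono-≤ (proj₁ (proj₂ Uu)) (neg-mono-≤ t₂≤0)
      0≤P₁ : 0ℤ ≤ j₁ + s₁
      0≤P₁ = +-mono-≤ (proj₁ (proj₁ Uj)) 0≤s₁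
      P₂≤N : j₂ + s₂ ≤ N
      P₂≤N = ≤-trans (+-mono-≤ (proj₂ (proj₂ Uj)) s₂≤0) (≤-reflexive (+-identityʳ N))
      regroup : (u ⊖ j) ⊖ (s ⊕ t) ≡ (u ⊖ t) ⊖ (j ⊕ s)
      regroup = begin
        (u ⊖ j) ⊖ (s ⊕ t)   ≡⟨ ⊖-⊕ (u ⊖ j) s t ⟩
        ((u ⊖ j) ⊖ s) ⊖ t   ≡⟨ ⊖-⊖-comm (u ⊖ j) s t ⟩
        ((u ⊖ j) ⊖ t) ⊖ s   ≡⟨ cong (_⊖ s) (⊖-⊖-comm u j t) ⟩
        ((u ⊖ t) ⊖ j) ⊖ s   ≡⟨ ⊖-⊕ (u ⊖ t) j s ⟨
        (u ⊖ t) ⊖ (j ⊕ s)   ∎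
      ≺j+s⇒K : ∀ {k} → Sq n k → k ≺ (j ⊕ s) → K k
      ≺j+s⇒K {k} Uk k≺P = JsK k (Uk , j , Jj , subst (InD p) (⊖-⊕ k j s) (prec k≺P))
      u-t≺K⇒L : ∀ {k} → K k → (u ⊖ t) ≺ k → L u
      u-t≺K⇒L {k} Kk Q≺k = KtL u (Uu , k , Kk , subst (InD p) (⊖-⊖-comm u t k) (prec Q≺k))
      conclude : Interpolant (u ⊖ t) (j ⊕ s) → L u
      conclude (through k Uk Q≺k k≺P) = u-t≺K⇒L (≺j+s⇒K Uk k≺P) Q≺k
      conclude (below-origin Q≺0)      = u-t≺K⇒L (nonempty-ideal∋origin K-ideal K≢∅) Q≺0
      conclude (above-corner N≺P)      = contradiction (ideal∋corner⇒≐Sq K-ideal (≺j+s⇒K Sq-corner N≺P)) K≢U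

open import Data.Nat using (_*_; _+_)

p≤1+[m/3]*[p∸1] : ∀ p m → .{{_ : NonZero m}} → 3 ∣ m → p ℕ.≤ suc ((m / 3) * (p ∸ 1))
p≤1+[m/3]*[p∸1] p m 3∣m = ℕ.≤-trans (ℕ.m≤n+m∸n p 1) (ℕ.s≤s (ℕ.m≤n*m (p ∸ 1) (m / 3) {{m/3≢0}}))
  where
  m/3≢0 : NonZero (m / 3)
  m/3≢0 = ℕ.>-nonZero (m≥n⇒m/n>0 (∣⇒≤ 3∣m))

lemma4p4 : (p m : ℕ) → Prime p → .{{_ : NonZero m}} → 3 ∣ m →
    let n = (m / 3) * (p ∸ 1) in
    (J K L : PtSet) → IsIdeal p (Sq n) J → IsIdeal p (Sq n) K → IsIdeal p (Sq n) L →
    (a b c d : ℕ) →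
    SumCap p J (+ a , - (+ b)) (Sq n) ⊆ K →
    SumCap p K (+ c , - (+ d)) (Sq n) ⊆ L →
    (∃ λ z → K z) →
    ¬ (K ≐ Sq n) →
    BoundaryWalkNotSingleHStep p (+ 0) (+ n) (+ 0) (+ n) K →
    SumCap p J (+ (a + c) , - (+ (b + d))) (Sq n) ⊆ L
lemma4p4 p m p-prime 3∣m J _ L J-ideal K-ideal _ a b c d JsK KtL K≢∅ K≢U _ =
  subst (λ s → SumCap p J s (Sq n) ⊆ L) (cong₂ _,_ (sym (pos-+ a c)) (sym -[b+d]))
    (SumCap-compose (proj₁ J-ideal) K-ideal (+≤+ ℕ.z≤n) neg-≤-pos (+≤+ ℕ.z≤n) neg-≤-pos JsK KtL K≢∅ K≢U)
  where
  n = (m / 3) * (p ∸ 1)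
  open Interpolation {{prime⇒nonZero p-prime}} (p≤1+[m/3]*[p∸1] p m 3∣m)
  -[b+d] : - (+ (b + d)) ≡ - (+ b) ℤ.+ - (+ d)
  -[b+d] = trans (cong -_ (pos-+ b d)) (neg-distrib-+ (+ b) (+ d))
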